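{- Let $C$ be a $k$-context and $c_1,c_2\in\mathcal{T}(C)$ (so $c_1,c_2$ are resource $k$-contexts). Let $\bar c_1,\bar c_2$ be rigids of $c_1,c_2$ respectively. For $i=1,\dots,k$ let $\vec v^{\,i}=\langle v^i_1,\dots,v^i_{\deg_{\Box_i}(c_1)}\rangle$ and $\vec u^{\,i}=\langle u^i_1,\dots,u^i_{\deg_{\Box_i}(c_2)}\rangle$ be lists of resource values. If $\bar c_1[\vec v^{\,1},\dots,\vec v^{\,k}]=\bar c_2[\vec u^{\,1},\dots,\vec u^{\,k}]$, then $c_1=c_2$ and $[\vec v^{\,i}]=[\vec u^{\,i}]$ for all $i$, where $[\vec w]$ denotes the multiset of the elements of the list $\vec w$.
   Context: A $k$-context is a $\lambda$-term ($M::=x\mid\lambda x.M\mid MM$) possibly containing holes $\Box_1,\dots,\Box_k$, each occurring any number of times. Resource values and resource simple terms: $v::=x\mid\lambda x.s$, $s::=s_1s_2\mid[v_1,\dots,v_n]$ ($[\cdots]$ finite multisets, "bags"), modulo $\alpha$. Resource $k$-contexts are defined by mutual induction, without $\alpha$-equivalence: value-contexts $c^v::=\Box_1\mid\cdots\mid\Box_k\mid x\mid\lambda x.c^s$ and simple-contexts $c^s::=c^s_1c^s_2\mid[c^v_1,\dots,c^v_n]$. $\deg_{\Box_i}(c)$ is the number of occurrences of $\Box_i$ in $c$. Taylor expansion of $k$-contexts: $\mathcal{T}(\Box_i)=\{[\Box_i,\dots,\Box_i]\ (m\text{ copies})\mid m\in\mathbb{N}\}$, $\mathcal{T}(x)=\{[x,\dots,x]\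 (m\text{ copies})\mid m\in\mathbb{N}\}$, $\mathcal{T}(\lambda x.C)=\{[\lambda x.s_1,\dots,\lambda x.s_m]\mid m\in\mathbb{N},s_j\in\mathcal{T}(C)\}$, $\mathcal{T}(C_1C_2)=\{s_1s_2\mid s_i\in\mathcal{T}(C_i)\}$. Rigid contexts are built like resource contexts but with lists $\langle\cdots\rangle$ in place of bags. The set $\mathrm{Rigid}(c)$ of rigids of a resource context $c$: $\mathrm{Rigid}(\Box_i)=\{\Box_i\}$, $\mathrm{Rigid}(x)=\{x\}$, $\mathrm{Rigid}(\lambda x.c_0)=\{\lambda x.\bar c_0\mid\bar c_0\in\mathrm{Rigid}(c_0)\}$, $\mathrm{Rigid}(c_0c_1)=\{\bar c_0\bar c_1\mid\bar c_i\in\mathrm{Rigid}(c_i)\}$, $\mathrm{Rigid}([c_1,\dots,c_m])=\{\langle\bar c_{\sigma(1)},\dots,\bar c_{\sigma(m)}\rangle\mid\sigma\text{ a permutation},\bar c_i\in\mathrm{Rigid}(c_i)\}$. Filling: for $\bar c$ a rigid of $c$ and lists $\vec v^{\,i}$ of resource values of length $\deg_{\Box_i}(c)$, the resource term $\bar c[\vec v^{\,1},\dots,\vec v^{\,k}]$ is defined by: if $\bar c=\Box_i$, $\bar c[\langle\rangle,\dots,\langle v^i_1\rangle,\dots,\langle\rangle]=v^i_1$; if $\bar c=x$, $\bar c[\langle\rangle,\dots,\langle\rangle]=x$; $(\lambda x.\bar c_0)[\vec v^{\,1},\dots,\vec v^{\,k}]=\lambda x.\bar c_0[\vec v^{\,1},\dots,\vec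 v^{\,k}]$; for $\bar c=\bar c_1\bar c_2$ with $\bar c_j$ a rigid of $c_j$, split each $\vec v^{\,i}=\vec w^{\,i1}\vec w^{\,i2}$ (concatenation) with $\vec w^{\,ij}$ of length $\deg_{\Box_i}(c_j)$ and set $\bar c[\ldots]=\bar c_1[\vec w^{\,11},\dots,\vec w^{\,k1}]\,\bar c_2[\vec w^{\,12},\dots,\vec w^{\,k2}]$; for $\bar c=\langle\bar c_{\sigma(1)},\dots,\bar c_{\sigma(m)}\rangle$ with $\bar c_j$ a rigid of $c_j$, split $\vec v^{\,i}=\vec w^{\,i1}\cdots\vec w^{\,im}$ with $\vec w^{\,ij}$ of length $\deg_{\Box_i}(c_{\sigma(j)})$ and set $\bar c[\ldots]=[\bar c_{\sigma(1)}[\vec w^{\,11},\dots,\vec w^{\,k1}],\dots,\bar c_{\sigma(m)}[\vec w^{\,1m},\dots,\vec w^{\,km}]]$ (a bag). -}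

module Defs where

open import Data.Nat using (ℕ)
open import Data.Fin using (Fin; _≟_)
open import Data.List using (List; []; _∷_; [_]; _++_; length; replicate; map)
open import Data.List.Relation.Unary.All using (All)
open import Data.List.Relation.Binary.Pointwise using (Pointwise)
open import Data.List.Relation.Binary.Permutation.Propositional using (_↭_)
open import Relation.Binary.PropositionalEquality using (_≡_; _≢_)
open import Relation.Nullary.Decidable using (⌊_⌋)
open import Data.Bool using (if_then_else_)

Name : Set
Name = ℕ

data Ctx (k : ℕ) : Set where
  hole : Fin k → Ctx k
  var  : Name → Ctx k
  lam  : Name → Ctx k → Ctx k
  app  : Ctx k → Ctx k → Ctx k

-- Bags are represented by lists; as multisets they are taken up to
-- permutation (see _≈ᶜS_ below).  The same syntax, read literally
-- (lists as lists), is used for rigid contexts.  Resource values and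
-- simple resource terms are the resource 0-contexts (no holes), taken
-- modulo α-equivalence and bag permutation (see AlphaS below).

data CV (k : ℕ) : Set
data CS (k : ℕ) : Set

data CV k where
  hole : Fin k → CV k
  var  : Name → CV k
  lam  : Name → CS k → CV k

data CS k where
  app : CS k → CS k → CS k
  bag : List (CV k) → CS k

Val : Set
Val = CV 0

Term : Set
Term = CS 0

degV : ∀ {k} → Fin k → CV k → ℕ
degS : ∀ {k} → Fin k → CS k → ℕ
degL : ∀ {k} → Fin k → List (CV k) → ℕ

degV i (hole j)  = if ⌊ i ≟ j ⌋ then 1 else 0
degV i (var x)   = 0
degV i (lam x s) = degS i s
degS i (app s t) = degS i s Data.Nat.+ degS i t
degS i (bag cs)  = degL i cs
degL i []        = 0
degL i (c ∷ cs)  = degV i c Data.Nat.+ degL i cs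

-- Taylor expansion: InT C c  means  c ∈ 𝒯(C).

data InT {k : ℕ} : Ctx k → CS k → Set where
  hole : ∀ i m → InT (hole i) (bag (replicate m (hole i)))
  var  : ∀ x m → InT (var x) (bag (replicate m (var x)))
  lam  : ∀ x {C} (ss : List (CS k)) → All (InT C) ss →
         InT (lam x C) (bag (map (lam x) ss))
  app  : ∀ {C₁ C₂ s₁ s₂} → InT C₁ s₁ → InT C₂ s₂ → InT (app C₁ C₂) (app s₁ s₂)

-- Equality of resource contexts (no α; bags as multisets).

data _≈ᶜV_ {k : ℕ} : CV k → CV k → Set
data _≈ᶜS_ {k : ℕ} : CS k → CS k → Set

data _≈ᶜV_ {k} where
  hole : ∀ i → hole i ≈ᶜV hole i
  var  : ∀ x → var x ≈ᶜV var x
  lam  : ∀ x {s t} → s ≈ᶜS t → lam x s ≈ᶜV lam x t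

data _≈ᶜS_ {k} where
  app : ∀ {s₁ s₂ t₁ t₂} → s₁ ≈ᶜS t₁ → s₂ ≈ᶜS t₂ → app s₁ s₂ ≈ᶜS app t₁ t₂
  bag : ∀ {cs ds es} → cs ↭ ds → Pointwise _≈ᶜV_ ds es → bag cs ≈ᶜS bag es

-- α-equivalence (with bags as multisets) on resource terms with named
-- variables, relative to the stacks of enclosing binders Γ, Δ.

data VarRel : List Name → List Name → Name → Name → Set where
  free  : ∀ {x} → VarRel [] [] x x
  here  : ∀ {x y Γ Δ} → VarRel (x ∷ Γ) (y ∷ Δ) x y
  there : ∀ {x y x′ y′ Γ Δ} → x ≢ x′ → y ≢ y′ →
          VarRel Γ Δ x y → VarRel (x′ ∷ Γ) (y′ ∷ Δ) x y

data AlphaV {k : ℕ} (Γ Δ : List Name) : CV k → CV k → Set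
data AlphaS {k : ℕ} (Γ Δ : List Name) : CS k → CS k → Set

data AlphaV {k} Γ Δ where
  hole : ∀ i → AlphaV Γ Δ (hole i) (hole i)
  var  : ∀ {x y} → VarRel Γ Δ x y → AlphaV Γ Δ (var x) (var y)
  lam  : ∀ {x y s t} → AlphaS (x ∷ Γ) (y ∷ Δ) s t → AlphaV Γ Δ (lam x s) (lam y t)

data AlphaS {k} Γ Δ where
  app : ∀ {s₁ s₂ t₁ t₂} → AlphaS Γ Δ s₁ t₁ → AlphaS Γ Δ s₂ t₂ →
        AlphaS Γ Δ (app s₁ s₂) (app t₁ t₂)
  bag : ∀ {vs ws us} → vs ↭ ws → Pointwise (AlphaV Γ Δ) ws us →
        AlphaS Γ Δ (bag vs) (bag us)

_≈ₜ_ : Term → Term → Set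
s ≈ₜ t = AlphaS [] [] s t

_≈ᵥ_ : Val → Val → Set
v ≈ᵥ w = AlphaV [] [] v w

_≈ᵇ_ : List Val → List Val → Set
vs ≈ᵇ us = Data.Product.∃ λ ws → (vs ↭ ws) Data.Product.× Pointwise _≈ᵥ_ ws us
  where import Data.Product

-- Rigids: RigidV c r  means  r ∈ Rigid(c)  (r read with lists as lists).

data RigidV {k : ℕ} : CV k → CV k → Set
data RigidS {k : ℕ} : CS k → CS k → Set

data RigidV {k} where
  hole : ∀ i → RigidV (hole i) (hole i)
  var  : ∀ x → RigidV (var x) (var x)
  lam  : ∀ x {c r} → RigidS c r → RigidV (lam x c) (lam x r)

data RigidS {k} where
  app : ∀ {c₁ c₂ r₁ r₂} → RigidS c₁ r₁ → RigidS c₂ r₂ → RigidS (app c₁ c₂) (app r₁ r₂)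
  bag : ∀ {cs ds rs} → cs ↭ ds → Pointwise RigidV ds rs → RigidS (bag cs) (bag rs)

-- Filling of a rigid context r with lists vs i of values (one list per
-- hole □_i): FillS r vs t  means  r[vs 1, …, vs k] = t.

data FillV {k : ℕ} : CV k → (Fin k → List Val) → Val → Set
data FillS {k : ℕ} : CS k → (Fin k → List Val) → Term → Set
data FillL {k : ℕ} : List (CV k) → (Fin k → List Val) → List Val → Set

data FillV {k} where
  hole : ∀ {j vs v} → vs j ≡ [ v ] → (∀ i → i ≢ j → vs i ≡ []) →
         FillV (hole j) vs v
  var  : ∀ {x vs} → (∀ i → vs i ≡ []) → FillV (var x) vs (var x)
  lam  : ∀ {x r vs t} → FillS r vs t → FillV (lam x r) vs (lam x t)

data FillS {k} where
  app : ∀ {r₁ r₂ vs ws₁ ws₂ t₁ t₂} →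
        (∀ i → vs i ≡ ws₁ i ++ ws₂ i) →
        (∀ i → length (ws₁ i) ≡ degS i r₁) →
        (∀ i → length (ws₂ i) ≡ degS i r₂) →
        FillS r₁ ws₁ t₁ → FillS r₂ ws₂ t₂ → FillS (app r₁ r₂) vs (app t₁ t₂)
  bag : ∀ {rs vs ts} → FillL rs vs ts → FillS (bag rs) vs (bag ts)

data FillL {k} where
  []  : ∀ {vs} → (∀ i → vs i ≡ []) → FillL [] vs []
  _∷_ : ∀ {r rs vs ws₁ ws₂ t ts} →
        (∀ i → vs i ≡ ws₁ i ++ ws₂ i) →
        (∀ i → length (ws₁ i) ≡ degV i r) →
        FillV r ws₁ t → FillL rs ws₂ ts → FillL (r ∷ rs) vs (t ∷ ts)

-- Applications split the filling lists into the parts used by the two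
-- sides, so only bags need care: a permutation of the filled bag lifts to a permutation
-- of its elements together with their rigids and filling lists, after which the
-- elements can be compared one by one. At a hole both filled values sit under the same
-- binders, because contexts are not taken modulo α; hence they are α-equivalent.
module Submission where

open import Defs
open import Data.Fin using (Fin; _≟_)
open import Data.List using (List; []; _∷_; [_]; _++_; length; map)
open import Data.List.Relation.Unary.All as All using (All; []; _∷_)
import Data.List.Relation.Unary.All.Properties as Allₚ
open import Data.List.Relation.Binary.Pointwise using (Pointwise; []; _∷_)
import Data.List.Relation.Binary.Pointwise as Pointwise
open import Data.List.Relation.Binary.Permutation.Propositional
  using (_↭_; refl; prep; swap; trans; ↭-sym)
open import Data.List.Relation.Binary.Permutation.Propositional.Properties
  using (↭-map-inv; ++⁺; ++⁺ˡ; shifts; All-resp-↭)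
  renaming (map⁺ to ↭-map⁺)
open import Data.Nat using (ℕ; suc; pred)
open import Data.Product using (_×_; ∃; _,_; -,_)
open import Relation.Binary.PropositionalEquality
  using (_≡_; refl; sym; cong; subst₂)
  renaming (trans to ≡-trans)
open import Relation.Nullary using (yes; no)
open import Function using (_∘_)

Pointwise-↭-commute : ∀ {A B : Set} {R : A → B → Set} {xs : List A} {ys ys′ : List B} →
                      Pointwise R xs ys → ys ↭ ys′ →
                      ∃ λ xs′ → xs ↭ xs′ × Pointwise R xs′ ys′
Pointwise-↭-commute rs refl = -, refl , rs
Pointwise-↭-commute (r ∷ rs) (prep _ p) with _ , q , rs′ ← Pointwise-↭-commute rs p =
  -, prep _ q , r ∷ rs′
Pointwise-↭-commute (r₁ ∷ r₂ ∷ rs) (swap _ _ p) with _ , q , rs′ ← Pointwise-↭-commute rs p =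
  -, swap _ _ q , r₂ ∷ r₁ ∷ rs′
Pointwise-↭-commute rs (trans p₁ p₂)
  with _ , q₁ , rs₁ ← Pointwise-↭-commute rs p₁
  with _ , q₂ , rs₂ ← Pointwise-↭-commute rs₁ p₂ = -, trans q₁ q₂ , rs₂

≈ᵇ-++ : ∀ {vs₁ vs₂ us₁ us₂} → vs₁ ≈ᵇ us₁ → vs₂ ≈ᵇ us₂ → (vs₁ ++ vs₂) ≈ᵇ (us₁ ++ us₂)
≈ᵇ-++ (_ , p₁ , α₁) (_ , p₂ , α₂) = -, ++⁺ p₁ p₂ , Pointwise.++⁺ α₁ α₂

≡[]-≈ᵇ : ∀ {vs us} → vs ≡ [] → us ≡ [] → vs ≈ᵇ us
≡[]-≈ᵇ refl refl = [] , refl , []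

↭-≈ᵇ-trans : ∀ {vs ws us} → vs ↭ ws → ws ≈ᵇ us → vs ≈ᵇ us
↭-≈ᵇ-trans p (_ , q , α) = -, trans p q , α

VarRel-same : ∀ {Γ x y} → VarRel Γ Γ x y → x ≡ y
VarRel-same free          = refl
VarRel-same here          = refl
VarRel-same (there _ _ r) = VarRel-same r

VarRel-strengthen : ∀ Δ₁ Δ₂ {Γ x y} → length Δ₁ ≡ length Δ₂ →
                    VarRel (Δ₁ ++ Γ) (Δ₂ ++ Γ) x y → VarRel Δ₁ Δ₂ x y
VarRel-strengthen []       []       _ r with refl ← VarRel-same r = free
VarRel-strengthen (_ ∷ Δ₁) (_ ∷ Δ₂) _ here = here
VarRel-strengthen (_ ∷ Δ₁) (_ ∷ Δ₂) e (there x≢ y≢ r) =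
  there x≢ y≢ (VarRel-strengthen Δ₁ Δ₂ (cong pred e) r)

module _ {k : ℕ} where

  AlphaV-strengthen : ∀ Δ₁ Δ₂ {Γ} {v w : CV k} → length Δ₁ ≡ length Δ₂ →
                      AlphaV (Δ₁ ++ Γ) (Δ₂ ++ Γ) v w → AlphaV Δ₁ Δ₂ v w
  AlphaS-strengthen : ∀ Δ₁ Δ₂ {Γ} {s t : CS k} → length Δ₁ ≡ length Δ₂ →
                      AlphaS (Δ₁ ++ Γ) (Δ₂ ++ Γ) s t → AlphaS Δ₁ Δ₂ s t
  Pointwise-AlphaV-strengthen : ∀ Δ₁ Δ₂ {Γ} {vs ws : List (CV k)} → length Δ₁ ≡ length Δ₂ →
                                Pointwise (AlphaV (Δ₁ ++ Γ) (Δ₂ ++ Γ)) vs ws →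
                                Pointwise (AlphaV Δ₁ Δ₂) vs ws

  AlphaV-strengthen Δ₁ Δ₂ e (hole i) = hole i
  AlphaV-strengthen Δ₁ Δ₂ e (var r)  = var (VarRel-strengthen Δ₁ Δ₂ e r)
  AlphaV-strengthen Δ₁ Δ₂ e (lam {x} {y} α) =
    lam (AlphaS-strengthen (x ∷ Δ₁) (y ∷ Δ₂) (cong suc e) α)
  AlphaS-strengthen Δ₁ Δ₂ e (app α β) =
    app (AlphaS-strengthen Δ₁ Δ₂ e α) (AlphaS-strengthen Δ₁ Δ₂ e β)
  AlphaS-strengthen Δ₁ Δ₂ e (bag p αs) = bag p (Pointwise-AlphaV-strengthen Δ₁ Δ₂ e αs)
  Pointwise-AlphaV-strengthen Δ₁ Δ₂ e []       = []
  Pointwise-AlphaV-strengthen Δ₁ Δ₂ e (α ∷ αs) =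
    AlphaV-strengthen Δ₁ Δ₂ e α ∷ Pointwise-AlphaV-strengthen Δ₁ Δ₂ e αs

AlphaV-close : ∀ {Γ} {v w : Val} → AlphaV Γ Γ v w → v ≈ᵥ w
AlphaV-close = AlphaV-strengthen [] [] refl

module _ {k : ℕ} where

  record Filling : Set where
    field
      {ctx rigid} : CV k
      args        : Fin k → List Val
      {value}     : Val
      isRigid     : RigidV ctx rigid
      fills       : FillV rigid args value
  open Filling

  allArgs : List Filling → Fin k → List Val
  allArgs []       i = []
  allArgs (q ∷ qs) i = args q i ++ allArgs qs i

  allArgs-↭ : ∀ {qs qs′} → qs ↭ qs′ → ∀ i → allArgs qs i ↭ allArgs qs′ i
  allArgs-↭ refl           i = refl
  allArgs-↭ (prep q p)     i = ++⁺ˡ (args q i) (allArgs-↭ p i)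
  allArgs-↭ (swap q₁ q₂ p) i =
    trans (shifts (args q₁ i) (args q₂ i)) (++⁺ˡ (args q₂ i) (++⁺ˡ (args q₁ i) (allArgs-↭ p i)))
  allArgs-↭ (trans p₁ p₂)  i = trans (allArgs-↭ p₁ i) (allArgs-↭ p₂ i)

  FillL-fillings : ∀ {ds rs vs ts} → Pointwise RigidV ds rs → FillL rs vs ts →
                   ∃ λ qs → map ctx qs ≡ ds × map value qs ≡ ts × (∀ i → vs i ≡ allArgs qs i)
  FillL-fillings [] ([] empty) = [] , refl , refl , empty
  FillL-fillings (rg ∷ rgs) (_∷_ {ws₁ = ws₁} split _ fv fl)
    with qs , refl , refl , split′ ← FillL-fillings rgs fl =
    record { args = ws₁ ; isRigid = rg ; fills = fv } ∷ qs , refl , refl ,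
    λ i → ≡-trans (split i) (cong (ws₁ i ++_) (split′ i))

  FillInjectiveOn : List Name → (CV k → Set) → Set
  FillInjectiveOn Γ P = ∀ {d₁ d₂ r₁ r₂ ws₁ ws₂ t₁ t₂} → P d₁ → P d₂ →
                        RigidV d₁ r₁ → RigidV d₂ r₂ → FillV r₁ ws₁ t₁ → FillV r₂ ws₂ t₂ →
                        AlphaV Γ Γ t₁ t₂ → d₁ ≈ᶜV d₂ × (∀ i → ws₁ i ≈ᵇ ws₂ i)

  module _ {Γ : List Name} {P : CV k → Set} (inj : FillInjectiveOn Γ P) where

    fillings-injective : ∀ {qs₁ qs₂} → All (P ∘ ctx) qs₁ → All (P ∘ ctx) qs₂ →
                         Pointwise (AlphaV Γ Γ) (map value qs₁) (map value qs₂) →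
                         Pointwise _≈ᶜV_ (map ctx qs₁) (map ctx qs₂) ×
                         (∀ i → allArgs qs₁ i ≈ᵇ allArgs qs₂ i)
    fillings-injective [] [] [] = [] , λ _ → ≡[]-≈ᵇ refl refl
    fillings-injective {q₁ ∷ _} {q₂ ∷ _} (p₁ ∷ ps₁) (p₂ ∷ ps₂) (α ∷ αs)
      with e , ≈ws ← inj p₁ p₂ (isRigid q₁) (isRigid q₂) (fills q₁) (fills q₂) α
      with es , ≈wss ← fillings-injective ps₁ ps₂ αs =
      e ∷ es , λ i → ≈ᵇ-++ (≈ws i) (≈wss i)

    bag-fill-injective : ∀ {cs₁ cs₂ rs₁ rs₂ vs us ts₁ ts₂} → All P cs₁ → All P cs₂ →
                         RigidS (bag cs₁) rs₁ → RigidS (bag cs₂) rs₂ →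
                         FillS rs₁ vs ts₁ → FillS rs₂ us ts₂ → AlphaS Γ Γ ts₁ ts₂ →
                         bag cs₁ ≈ᶜS bag cs₂ × (∀ i → vs i ≈ᵇ us i)
    bag-fill-injective ps₁ ps₂ (bag p₁ rgs₁) (bag p₂ rgs₂) (bag fl₁) (bag fl₂) (bag σ αs)
      with qs₁ , refl , refl , split₁ ← FillL-fillings rgs₁ fl₁
      with qs₂ , refl , refl , split₂ ← FillL-fillings rgs₂ fl₂
      with qs₁′ , refl , τ ← ↭-map-inv value σ
      with es , ≈wss ← fillings-injective (All-resp-↭ τ (Allₚ.map⁻ (All-resp-↭ p₁ ps₁)))
                                          (Allₚ.map⁻ (All-resp-↭ p₂ ps₂)) αs
      with _ , π , es′ ← Pointwise-↭-commute es (↭-sym p₂) =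
      bag (trans p₁ (trans (↭-map⁺ ctx τ) π)) es′ ,
      λ i → subst₂ _≈ᵇ_ (sym (split₁ i)) (sym (split₂ i)) (↭-≈ᵇ-trans (allArgs-↭ τ i) (≈wss i))

module _ {k : ℕ} where

  -- InTᵛ C d: d is an element of some bag in 𝒯(C), for C not an application.
  data InTᵛ : Ctx k → CV k → Set where
    hole : ∀ i → InTᵛ (hole i) (hole i)
    var  : ∀ x → InTᵛ (var x) (var x)
    lam  : ∀ x {C s} → InT C s → InTᵛ (lam x C) (lam x s)

  hole-args-≈ᵇ : ∀ {j t₁ t₂} {ws₁ ws₂ : Fin k → List Val} →
                 FillV (hole j) ws₁ t₁ → FillV (hole j) ws₂ t₂ → t₁ ≈ᵥ t₂ →
                 ∀ i → ws₁ i ≈ᵇ ws₂ i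
  hole-args-≈ᵇ {j} (hole at₁ off₁) (hole at₂ off₂) α i with i ≟ j
  ... | yes refl = subst₂ _≈ᵇ_ (sym at₁) (sym at₂) ([ _ ] , refl , α ∷ [])
  ... | no i≢j   = ≡[]-≈ᵇ (off₁ i i≢j) (off₂ i i≢j)

  fill-injectiveᵛ : ∀ {Γ} (C : Ctx k) → FillInjectiveOn Γ (InTᵛ C)
  fill-injectiveˢ : ∀ {Γ} (C : Ctx k) {c₁ c₂ r₁ r₂ vs us t₁ t₂} → InT C c₁ → InT C c₂ →
                    RigidS c₁ r₁ → RigidS c₂ r₂ → FillS r₁ vs t₁ → FillS r₂ us t₂ →
                    AlphaS Γ Γ t₁ t₂ → c₁ ≈ᶜS c₂ × (∀ i → vs i ≈ᵇ us i)

  fill-injectiveᵛ (hole j) (hole _) (hole _) (hole _) (hole _) f₁ f₂ α =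
    hole j , hole-args-≈ᵇ f₁ f₂ (AlphaV-close α)
  fill-injectiveᵛ (var x) (var _) (var _) (var _) (var _) (var off₁) (var off₂) _ =
    var x , λ i → ≡[]-≈ᵇ (off₁ i) (off₂ i)
  fill-injectiveᵛ (lam x C) (lam _ i₁) (lam _ i₂) (lam _ rg₁) (lam _ rg₂) (lam f₁) (lam f₂) (lam α)
    with e , ≈ws ← fill-injectiveˢ C i₁ i₂ rg₁ rg₂ f₁ f₂ α = lam x e , ≈ws

  fill-injectiveˢ (hole j) (hole _ m₁) (hole _ m₂) =
    bag-fill-injective (fill-injectiveᵛ (hole j))
      (Allₚ.replicate⁺ m₁ (hole j)) (Allₚ.replicate⁺ m₂ (hole j))
  fill-injectiveˢ (var x) (var _ m₁) (var _ m₂) =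
    bag-fill-injective (fill-injectiveᵛ (var x))
      (Allₚ.replicate⁺ m₁ (var x)) (Allₚ.replicate⁺ m₂ (var x))
  fill-injectiveˢ (lam x C) (lam _ _ is₁) (lam _ _ is₂) =
    bag-fill-injective (fill-injectiveᵛ (lam x C))
      (Allₚ.map⁺ (All.map (lam x) is₁)) (Allₚ.map⁺ (All.map (lam x) is₂))
  fill-injectiveˢ (app C₁ C₂) (app i₁ j₁) (app i₂ j₂) (app rg₁ rg₁′) (app rg₂ rg₂′)
                  (app split₁ _ _ f₁ f₁′) (app split₂ _ _ f₂ f₂′) (app α α′)
    with e , ≈ws ← fill-injectiveˢ C₁ i₁ i₂ rg₁ rg₂ f₁ f₂ α
    with e′ , ≈ws′ ← fill-injectiveˢ C₂ j₁ j₂ rg₁′ rg₂′ f₁′ f₂′ α′ =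
    app e e′ , λ i → subst₂ _≈ᵇ_ (sym (split₁ i)) (sym (split₂ i)) (≈ᵇ-++ (≈ws i) (≈ws′ i))

mainTheorem3 : ∀ {k} (C : Ctx k) (c₁ c₂ : CS k) → InT C c₁ → InT C c₂ →
               (r₁ r₂ : CS k) → RigidS c₁ r₁ → RigidS c₂ r₂ →
               (vs us : Fin k → List Val) →
               (∀ i → length (vs i) ≡ degS i c₁) →
               (∀ i → length (us i) ≡ degS i c₂) →
               (t₁ t₂ : Term) → FillS r₁ vs t₁ → FillS r₂ us t₂ → t₁ ≈ₜ t₂ →
               c₁ ≈ᶜS c₂ × (∀ i → vs i ≈ᵇ us i)
mainTheorem3 C _ _ i₁ i₂ _ _ rg₁ rg₂ _ _ _ _ _ _ f₁ f₂ α = fill-injectiveˢ C i₁ i₂ rg₁ rg₂ f₁ f₂ α
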